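{- In the setting of the procedure AbstractFlow described in the context, for all indices $i>j$ there is no $s_i$-to-$t_j$ path in $G$ that is residual with respect to $\mathbf{c}_0$, nor with respect to $\mathbf{c}_{k\ell}$ for any $k<\ell$.
   Context: $G$ is a planar embedded graph; each edge is viewed as two oppositely directed darts, and every dart $d$ has a capacity $\mathbf{c}[d]\ge 0$ (capacities need not be symmetric). A flow $\mathbf{f}$ is an antisymmetric assignment of reals to darts ($\mathbf{f}[\mathrm{rev}(d)]=-\mathbf{f}[d]$) with $\mathbf{f}[d]\le \mathbf{c}[d]$, balanced at every non-terminal vertex; its value is the net flow entering the sinks. The residual capacities w.r.t. $\mathbf{f}$ are $\mathbf{c}_{\mathbf{f}}[d]=\mathbf{c}[d]-\mathbf{f}[d]$. A path or cycle is residual w.r.t. given capacities if every dart on it has strictly positive capacity. The face $f_\infty$ chosen as the infinite face contains all terminals on its boundary; clockwise/counterclockwise for simple cycles is with respect to this choice. A flow is leftmost (w.r.t. capacities $\mathbf{c}$) if no clockwise cycle is residual w.r.t. $\mathbf{c}_{\mathbf{f}}$. The terminals are sources and sinks alternating along the boundary in clockwise order $s_1,t_1,s_2,t_2,\dots,s_m,t_m$. Procedure AbstractFlow: first, starting from $\mathbf{c}$, saturate all $s_j$-to-$t_i$ residual paths for all $i<j$ and all clockwise residual cycles, obtaining residual capacities $\mathbf{c}_0$ with respect to which no clockwise cycle and no $s_j$-to-$t_i$ path ($i<j$) is residual. Then for $j=1,2,\dots,m$ and, inside, for $i=j,j-1,\dots,1$: let $\mathbf{c}'_{ij}$ be the current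 residual capacities; let $\mathbf{f}_{ij}$ be a leftmost maximum $s_i$-to-$t_j$ flow w.r.t. $\mathbf{c}'_{ij}$; let $\mathbf{c}_{ij}$ be the residual capacities of $\mathbf{c}'_{ij}$ w.r.t. $\mathbf{f}_{ij}$ (these become the current residual capacities).
   Formalization: Capacities, flows and residual capacities take values in the rationals rather than the reals, and each $\mathbf{f}_{ij}$ is maximum among rational flows. -}

module Defs where

open import Data.Nat using (ℕ; zero; suc; _+_; _*_; _≤_; _<_; _≤ᵇ_; _<ᵇ_)
open import Data.Fin using (Fin; toℕ; _≟_)
open import Data.Bool using (Bool; true; false; if_then_else_; _∨_; _∧_; not)
open import Data.List using (List; []; _∷_; allFin; upTo; map; foldr; length)
open import Data.List.Relation.Unary.All using (All)
open import Data.List.Relation.Unary.Unique.Propositional using (Unique)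
open import Data.List.Membership.Propositional using (_∈_; _∉_)
open import Data.Product using (Σ; ∃; ∃-syntax; _×_; _,_)
open import Data.Sum using (_⊎_)
open import Relation.Binary.PropositionalEquality using (_≡_; _≢_)
open import Relation.Nullary using (¬_; does)
open import Data.Rational as ℚ using (ℚ; 0ℚ)

iter : ∀ {A : Set} → ℕ → (A → A) → A → A
iter zero    f x = x
iter (suc k) f x = f (iter k f x)

allB : ∀ {A : Set} → (A → Bool) → List A → Bool
allB p = foldr (λ x b → p x ∧ b) true

count : ∀ {n} → (Fin n → Bool) → ℕ
count {n} p = foldr _+_ 0 (map (λ x → if p x then 1 else 0) (allFin n))

-- number of orbits of a function π on Fin n (π a permutation):
-- count the darts that are minimal (w.r.t. toℕ) in their π-orbit
orbitCount : ∀ n → (Fin n → Fin n) → ℕ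
orbitCount n π = count (λ d → allB (λ k → toℕ d ≤ᵇ toℕ (iter k π d)) (upTo n))

reachSet : ∀ {n} → (Fin n → Fin n) → (Fin n → Fin n) → ℕ → Fin n → Fin n → Bool
reachSet rev rot⁻ zero    d x = does (d ≟ x)
reachSet rev rot⁻ (suc k) d x =
  reachSet rev rot⁻ k d x ∨ reachSet rev rot⁻ k d (rev x) ∨ reachSet rev rot⁻ k d (rot⁻ x)

-- number of connected components of the combinatorial map
-- (orbits of the group generated by rev and rot)
componentCount : ∀ n → (Fin n → Fin n) → (Fin n → Fin n) → ℕ
componentCount n rev rot⁻ =
  count (λ d → allB (λ x → not ((toℕ x <ᵇ toℕ d) ∧ reachSet rev rot⁻ n x d)) (allFin n))

-- Planar embedded graphs as combinatorial maps (rotation systems).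
-- Darts are Fin nD; each edge = a pair {d , rev d}.  rot d is the next dart
-- CLOCKWISE around the tail of d.  The face to the LEFT of d is the orbit of
-- d under  φ d = rot (rev d).  Planarity = Euler's formula (genus 0 in every
-- component):  V - E + F = 2 C, with E = nD/2, V counted as rot-orbits
-- (non-isolated vertices; isolated vertices do not affect planarity).

record PlaneGraph : Set where
  field
    nV nD   : ℕ
    tl      : Fin nD → Fin nV
    rev     : Fin nD → Fin nD
    rev-invol : ∀ d → rev (rev d) ≡ d
    rev-nofix : ∀ d → rev d ≢ d
    rot     : Fin nD → Fin nD
    rot⁻    : Fin nD → Fin nD
    rot-inv₁ : ∀ d → rot⁻ (rot d) ≡ d
    rot-inv₂ : ∀ d → rot (rot⁻ d) ≡ d
    rot-tl   : ∀ d → tl (rot d) ≡ tl d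
    rot-vertex : ∀ d d' → tl d ≡ tl d' → ∃[ k ] iter k rot d ≡ d'
    planar  : 2 * (orbitCount nD rot + orbitCount nD (λ d → rot (rev d)))
              ≡ nD + 4 * componentCount nD rev rot⁻

module _ (G : PlaneGraph) where
  open PlaneGraph G

  Vertex Dart : Set
  Vertex = Fin nV
  Dart   = Fin nD

  hd : Dart → Vertex
  hd d = tl (rev d)

  φ : Dart → Dart
  φ d = rot (rev d)

  SameFace : Dart → Dart → Set
  SameFace d d' = ∃[ k ] iter k φ d ≡ d'

  data Walk : Vertex → Vertex → Set where
    []  : ∀ {v} → Walk v v
    _∷_ : ∀ {w} (d : Dart) → Walk (hd d) w → Walk (tl d) w

  darts : ∀ {v w} → Walk v w → List Dart
  darts []       = []
  darts (d ∷ p)  = d ∷ darts p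

  vertices : ∀ {v w} → Walk v w → List Vertex
  vertices {v} []  = v ∷ []
  vertices (d ∷ p) = tl d ∷ vertices p

  IsSimplePath : ∀ {v w} → Walk v w → Set
  IsSimplePath p = Unique (vertices p)

  IsSimpleCycle : ∀ {v} → Walk v v → Set
  IsSimpleCycle p =
    (1 ≤ length (darts p)) ×
    Unique (map tl (darts p)) ×
    (∀ d → d ∈ darts p → rev d ∉ darts p)

  -- Orientation of simple cycles w.r.t. the infinite face (the face on
  -- the left of the dart d∞).  Outside C d : the face on the left of d is
  -- reachable from f∞ in the dual graph without crossing an edge of C.

  data Outside (d∞ : Dart) (C : List Dart) : Dart → Set where
    base  : ∀ {d} → SameFace d∞ d → Outside d∞ C d
    face  : ∀ {d d'} → Outside d∞ C d → SameFace d d' → Outside d∞ C d'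
    cross : ∀ {d} → Outside d∞ C d → d ∉ C → rev d ∉ C → Outside d∞ C (rev d)

  -- clockwise: the interior lies to the right, i.e. f∞ lies to the left
  -- of every dart of the cycle
  IsClockwise : Dart → ∀ {v} → Walk v v → Set
  IsClockwise d∞ p = IsSimpleCycle p × All (Outside d∞ (darts p)) (darts p)

  Cap : Set
  Cap = Dart → ℚ

  residual : Cap → (Dart → ℚ) → Cap
  residual c f d = c d ℚ.- f d

  ResidualWalk : Cap → ∀ {v w} → Walk v w → Set
  ResidualWalk c p = All (λ d → 0ℚ ℚ.< c d) (darts p)

  HasResidualPath : Cap → Vertex → Vertex → Set
  HasResidualPath c v w = Σ (Walk v w) λ p → IsSimplePath p × ResidualWalk c p

  NoClockwiseResidual : Dart → Cap → Set
  NoClockwiseResidual d∞ c = ∀ v (p : Walk v v) → IsClockwise d∞ p → ¬ ResidualWalk c p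

  inflow : (Dart → ℚ) → Vertex → ℚ
  inflow f v = foldr ℚ._+_ 0ℚ (map (λ d → if does (hd d ≟ v) then f d else 0ℚ) (allFin nD))

  IsPseudoflow : Cap → (Dart → ℚ) → Set
  IsPseudoflow c f = (∀ d → f (rev d) ≡ ℚ.- f d) × (∀ d → f d ℚ.≤ c d)

  IsFlow : Cap → (Vertex → Set) → (Dart → ℚ) → Set
  IsFlow c Term f = IsPseudoflow c f × (∀ v → ¬ Term v → inflow f v ≡ 0ℚ)

  -- s-to-t flow; its value is inflow f t
  IsSTFlow : Cap → Vertex → Vertex → (Dart → ℚ) → Set
  IsSTFlow c s t f = IsFlow c (λ v → (v ≡ s) ⊎ (v ≡ t)) f

  IsMaxSTFlow : Cap → Vertex → Vertex → (Dart → ℚ) → Set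
  IsMaxSTFlow c s t f =
    IsSTFlow c s t f × (∀ g → IsSTFlow c s t g → inflow g t ℚ.≤ inflow f t)

  IsLeftmost : Dart → Cap → (Dart → ℚ) → Set
  IsLeftmost d∞ c f = NoClockwiseResidual d∞ (residual c f)

  -- Terminals s₀,t₀,s₁,t₁,…,s_{m-1},t_{m-1} (0-indexed) on the boundary
  -- of f∞, in clockwise order (= order along the φ-orbit of d∞, within
  -- one period of that orbit).

  record Terminals : Set where
    field
      d∞    : Dart
      m     : ℕ
      s t   : ℕ → Vertex
      ps pt : ℕ → ℕ
      s-on  : ∀ i → i < m → tl (iter (ps i) φ d∞) ≡ s i
      t-on  : ∀ i → i < m → tl (iter (pt i) φ d∞) ≡ t i
      st-ord : ∀ i → i < m → ps i < pt i
      ts-ord : ∀ i → suc i < m → pt i < ps (suc i)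
      one-period : ∀ i → i < m → ∀ k → 1 ≤ k → k ≤ pt i → iter k φ d∞ ≢ d∞
      s-inj : ∀ i j → i < m → j < m → s i ≡ s j → i ≡ j
      t-inj : ∀ i j → i < m → j < m → t i ≡ t j → i ≡ j
      st-disj : ∀ i j → i < m → j < m → s i ≢ t j

    IsTerminal : Vertex → Set
    IsTerminal v = ∃[ i ] (i < m) × ((v ≡ s i) ⊎ (v ≡ t i))

  -- A run of procedure AbstractFlow with initial capacities c.
  -- (0-indexed: the loop is j = 0..m-1, i = j, j-1, …, 0.)
  --   cin i j  = c'_{ij},  fl i j = f_{ij},  cout i j = c_{ij}.

  record AbstractFlowRun (T : Terminals) (c : Cap) : Set where
    open Terminals T
    field
      f₀      : Dart → ℚ
      f₀-flow : IsFlow c IsTerminal f₀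
    c₀ : Cap
    c₀ = residual c f₀
    field
      c₀-noCW   : NoClockwiseResidual d∞ c₀
      c₀-noBack : ∀ i j → i < j → j < m → ¬ HasResidualPath c₀ (s j) (t i)
      cin cout : ℕ → ℕ → Cap
      fl       : ℕ → ℕ → (Dart → ℚ)
      cin-first : ∀ d → cin 0 0 d ≡ c₀ d
      cin-diag  : ∀ j → suc j < m → ∀ d → cin (suc j) (suc j) d ≡ cout 0 j d
      cin-off   : ∀ i j → i < j → j < m → ∀ d → cin i j d ≡ cout (suc i) j d
      fl-max    : ∀ i j → i ≤ j → j < m → IsMaxSTFlow (cin i j) (s i) (t j) (fl i j)
      fl-left   : ∀ i j → i ≤ j → j < m → IsLeftmost d∞ (cin i j) (fl i j)
      cout-def  : ∀ i j → i ≤ j → j < m → ∀ d → cout i j d ≡ residual (cin i j) (fl i j) d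

{-# OPTIONS --safe #-}
-- Each capacity function produced by AbstractFlow is the residual of its predecessor c with
-- respect to a maximum s_i-to-t_j flow f, whose value is nonnegative. Such a step creates no
-- residual x-to-y path that was not there before, provided x reaches neither y nor t_j, or
-- neither x nor s_i reaches y: then the vertices reached from x (resp. not reaching y) form a
-- set S that no residual dart leaves and into which f sends no positive net flow. The flow on
-- the darts entering S is nonnegative, as their reverses have no residual capacity, so it is
-- zero and the darts leaving S keep no residual capacity. Together with the absence of
-- augmenting paths for a maximum flow, this maintains along the loop that no s_a-to-t_b path
-- with b < a is residual and that, after step (i, j), no s_a-to-t_j path with i ≤ a ≤ j is.
module Submission where

open import Defs
open import Data.Nat as ℕ using (ℕ; zero; suc; _<_)
import Data.Nat.Properties as ℕP
open import Data.Rational as ℚ using (ℚ; 0ℚ; 1ℚ; _+_; _*_; -_; _-_; _≤_)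
import Data.Rational.Properties as ℚP
open import Data.Rational.Solver using (module +-*-Solver)
open import Algebra.Bundles using (CommutativeRing)
open import Algebra.Properties.Semiring.Sum (CommutativeRing.semiring ℚP.+-*-commutativeRing)
  using (sum; sum-syntax; ∑-distrib-+; ∑-comm; ∑-permute; sum-cong-≗; sum-replicate-zero; *-distribˡ-sum)
open import Algebra.Properties.Group ℚP.+-0-group using (⁻¹-involutive)
open import Data.Bool using (true; false; if_then_else_)
open import Data.Fin using (Fin; zero; suc; _≟_)
open import Data.Fin.Permutation using (permutation)
open import Data.Fin.Properties using (sequence)
open import Data.List as List using (foldr; allFin; tabulate)
open import Data.List.Properties using (map-tabulate)
open import Data.List.Relation.Unary.All as All using (All; []; _∷_)
open import Data.List.Relation.Unary.All.Properties using (¬Any⇒All¬)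
open import Data.List.Relation.Unary.Any using (here; there; any?)
open import Data.List.Relation.Unary.AllPairs using ([]; _∷_)
open import Data.List.Membership.Propositional using (_∈_)
open import Data.Product using (Σ; _×_; _,_; proj₁; proj₂)
open import Data.Sum using (_⊎_; inj₁; inj₂)
open import Effect.Monad using (RawMonad)
open import Function using (_∘_; id)
open import Relation.Binary using (tri<; tri≈; tri>)
open import Relation.Binary.PropositionalEquality
open import Relation.Nullary using (¬_; yes; no; does; contradiction)
open import Relation.Nullary.Decidable using (¬¬-excluded-middle)
open import Relation.Nullary.Negation using (¬¬-Monad; contradiction₂)
open import Relation.Unary using (Pred; Decidable)
open import Relation.Unary.Properties using (U?)
open import Level using (0ℓ)

-- Lets the cut arguments split on reachability: all their goals are negations.
¬¬-decidable : ∀ {n} (P : Pred (Fin n) 0ℓ) → ¬ ¬ Decidable P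
¬¬-decidable P = sequence (RawMonad.rawApplicative ¬¬-Monad) (λ _ → ¬¬-excluded-middle)

downwardInduction : ∀ {ℓ} {P : ℕ → Set ℓ} {j} → P j → (∀ i → i < j → P (suc i) → P i) → ∀ i → i ℕ.≤ j → P i
downwardInduction {P = P} {j} Pj step i i≤j = fromGap (j ℕ.∸ i) i (ℕP.m∸n+n≡m i≤j)
  where
  fromGap : ∀ k i → k ℕ.+ i ≡ j → P i
  fromGap zero    i i≡j = subst P (sym i≡j) Pj
  fromGap (suc k) i k+1+i≡j =
    step i (subst (i <_) k+1+i≡j (ℕP.m<n+m i ℕ.z<s)) (fromGap k (suc i) (trans (ℕP.+-suc k i) k+1+i≡j))

foldr-tabulate : ∀ n (g : Fin n → ℚ) → foldr _+_ 0ℚ (tabulate g) ≡ sum g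
foldr-tabulate zero    g = refl
foldr-tabulate (suc n) g = cong (g zero +_) (foldr-tabulate n (g ∘ suc))

foldr-map-allFin : ∀ n (g : Fin n → ℚ) → foldr _+_ 0ℚ (List.map g (allFin n)) ≡ sum g
foldr-map-allFin n g = trans (cong (foldr _+_ 0ℚ) (map-tabulate id g)) (foldr-tabulate n g)

∑-neg : ∀ {n} (g : Fin n → ℚ) → ∑[ i < n ] (- g i) ≡ - sum g
∑-neg {zero}  g = refl
∑-neg {suc n} g = trans (cong (- g zero +_) (∑-neg (g ∘ suc))) (sym (ℚP.neg-distrib-+ (g zero) _))

x≡-x⇒x≡0 : ∀ x → x ≡ - x → x ≡ 0ℚ
x≡-x⇒x≡0 x x≡-x with ℚP.<-cmp x 0ℚ
... | tri< x<0 _ _ = contradiction (subst (0ℚ ℚ.<_) (sym x≡-x) (ℚP.neg-antimono-< x<0)) (ℚP.<-asym x<0)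
... | tri≈ _ x≡0 _ = x≡0
... | tri> _ _ x>0 = contradiction (subst (ℚ._< 0ℚ) (sym x≡-x) (ℚP.neg-antimono-< x>0)) (ℚP.<-asym x>0)

∑-antisymmetric : ∀ {n} (r : Fin n → Fin n) → (∀ i → r (r i) ≡ i) →
                  (g : Fin n → ℚ) → (∀ i → g (r i) ≡ - g i) → sum g ≡ 0ℚ
∑-antisymmetric r r-invol g g-anti = x≡-x⇒x≡0 (sum g) (begin
  sum g                 ≡⟨ ∑-permute g (permutation r r r-invol r-invol) ⟩
  ∑[ i < _ ] g (r i)    ≡⟨ sum-cong-≗ g-anti ⟩
  ∑[ i < _ ] (- g i)    ≡⟨ ∑-neg g ⟩
  - sum g               ∎)
  where open ≡-Reasoning

∑-nonneg : ∀ {n} (g : Fin n → ℚ) → (∀ i → 0ℚ ≤ g i) → 0ℚ ≤ sum g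
∑-nonneg {zero}  g g≥0 = ℚP.≤-refl
∑-nonneg {suc n} g g≥0 = ℚP.+-mono-≤ (g≥0 zero) (∑-nonneg (g ∘ suc) (g≥0 ∘ suc))

term≤∑ : ∀ {n} (g : Fin n → ℚ) → (∀ i → 0ℚ ≤ g i) → ∀ i → g i ≤ sum g
term≤∑ {suc n} g g≥0 zero = subst (_≤ sum g) (ℚP.+-identityʳ (g zero))
  (ℚP.+-monoʳ-≤ (g zero) (∑-nonneg (g ∘ suc) (g≥0 ∘ suc)))
term≤∑ {suc n} g g≥0 (suc i) = subst (_≤ sum g) (ℚP.+-identityˡ (g (suc i)))
  (ℚP.+-mono-≤ (g≥0 zero) (term≤∑ (g ∘ suc) (g≥0 ∘ suc) i))

∑-indicator : ∀ {n} (w : Fin n) (g : Fin n → ℚ) → ∑[ v < n ] (if does (w ≟ v) then g v else 0ℚ) ≡ g w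
∑-indicator {suc n} zero g =
  trans (cong (g zero +_) (sum-replicate-zero n)) (ℚP.+-identityʳ (g zero))
∑-indicator {suc n} (suc w) g =
  trans (cong (0ℚ +_) (∑-indicator w (g ∘ suc))) (ℚP.+-identityˡ _)

if-+ : ∀ b x y → (if b then x + y else 0ℚ) ≡ (if b then x else 0ℚ) + (if b then y else 0ℚ)
if-+ true  x y = refl
if-+ false x y = refl

if-neg : ∀ b x → (if b then - x else 0ℚ) ≡ - (if b then x else 0ℚ)
if-neg true  x = refl
if-neg false x = refl

if-* : ∀ b k x → (if b then k * x else 0ℚ) ≡ k * (if b then x else 0ℚ)
if-* true  k x = refl
if-* false k x = sym (ℚP.*-zeroʳ k)

indicator : ∀ {n} → Fin n → Fin n → ℚ
indicator a b = if does (a ≟ b) then 1ℚ else 0ℚ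

indicator-refl : ∀ {n} (a : Fin n) → indicator a a ≡ 1ℚ
indicator-refl a with a ≟ a
... | yes _   = refl
... | no a≢a = contradiction refl a≢a

indicator-≢ : ∀ {n} {a b : Fin n} → a ≢ b → indicator a b ≡ 0ℚ
indicator-≢ {a = a} {b} a≢b with a ≟ b
... | yes a≡b = contradiction a≡b a≢b
... | no _    = refl

indicator-involution : ∀ {n} (r : Fin n → Fin n) → (∀ i → r (r i) ≡ i) →
                       ∀ a b → indicator a (r b) ≡ indicator (r a) b
indicator-involution r r-invol a b with a ≟ r b | r a ≟ b
... | yes _      | yes _ = refl
... | no _       | no _  = refl
... | yes refl   | no ra≢b = contradiction (r-invol b) ra≢b
... | no a≢rb    | yes refl = contradiction (sym (r-invol a)) a≢rb

module _ (G : PlaneGraph) where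
  open PlaneGraph G

  HasResidualWalk : Cap G → Vertex G → Vertex G → Set
  HasResidualWalk c x y = Σ (Walk G x y) (ResidualWalk G c)

  residualPath-suffix : ∀ {c x y z} (p : Walk G x y) → z ∈ vertices G p →
                        IsSimplePath G p → ResidualWalk G c p → HasResidualPath G c z y
  residualPath-suffix []      (here refl) simple res           = [] , simple , res
  residualPath-suffix (d ∷ p) (here refl) simple res           = d ∷ p , simple , res
  residualPath-suffix (d ∷ p) (there z∈p) (_ ∷ simple) (_ ∷ res) = residualPath-suffix p z∈p simple res

  residualWalk⇒residualPath : ∀ {c x y} → HasResidualWalk c x y → HasResidualPath G c x y
  residualWalk⇒residualPath ([] , []) = [] , [] ∷ [] , []
  residualWalk⇒residualPath (d ∷ p , r ∷ res) with residualWalk⇒residualPath (p , res)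
  ... | q , simple , resq with any? (tl d ≟_) (vertices G q)
  ...   | yes tl∈q = residualPath-suffix q tl∈q simple resq
  ...   | no  tl∉q = d ∷ q , ¬Any⇒All¬ _ tl∉q ∷ simple , r ∷ resq

  ¬residualPath⇒¬residualWalk : ∀ {c x y} → ¬ HasResidualPath G c x y → ¬ HasResidualWalk c x y
  ¬residualPath⇒¬residualWalk ¬path walk = ¬path (residualWalk⇒residualPath walk)

  residualWalk-∷ʳ : ∀ {c x} d → HasResidualWalk c x (tl d) → 0ℚ ℚ.< c d → HasResidualWalk c x (hd G d)
  residualWalk-∷ʳ d ([] , [])           r = d ∷ [] , r ∷ []
  residualWalk-∷ʳ d (e ∷ p , re ∷ res) r =
    let q , resq = residualWalk-∷ʳ d (p , res) r in e ∷ q , re ∷ resq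

  ¬residualPath-cong : ∀ {c c′} → (∀ d → c d ≡ c′ d) → ∀ {x y} →
                       ¬ HasResidualPath G c x y → ¬ HasResidualPath G c′ x y
  ¬residualPath-cong c≗c′ ¬path (p , simple , res) =
    ¬path (p , simple , All.map (λ {d} → subst (0ℚ ℚ.<_) (sym (c≗c′ d))) res)

  hd-rev : ∀ d → hd G (rev d) ≡ tl d
  hd-rev d = cong tl (rev-invol d)

  inflowTerm : Vertex G → (Dart G → ℚ) → Dart G → ℚ
  inflowTerm v f d = if does (hd G d ≟ v) then f d else 0ℚ

  inflow-∑ : ∀ f v → inflow G f v ≡ ∑[ d < nD ] inflowTerm v f d
  inflow-∑ f v = foldr-map-allFin nD (inflowTerm v f)

  inflow-+ : ∀ f g v → inflow G (λ d → f d + g d) v ≡ inflow G f v + inflow G g v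
  inflow-+ f g v = begin
    inflow G (λ d → f d + g d) v                               ≡⟨ inflow-∑ _ v ⟩
    ∑[ d < nD ] inflowTerm v (λ e → f e + g e) d               ≡⟨ sum-cong-≗ (λ d → if-+ (does (hd G d ≟ v)) (f d) (g d)) ⟩
    ∑[ d < nD ] (inflowTerm v f d + inflowTerm v g d)          ≡⟨ ∑-distrib-+ (inflowTerm v f) (inflowTerm v g) ⟩
    ∑[ d < nD ] inflowTerm v f d + ∑[ d < nD ] inflowTerm v g d ≡⟨ sym (cong₂ _+_ (inflow-∑ f v) (inflow-∑ g v)) ⟩
    inflow G f v + inflow G g v                                ∎
    where open ≡-Reasoning

  inflow-neg : ∀ f v → inflow G (λ d → - f d) v ≡ - inflow G f v
  inflow-neg f v = begin
    inflow G (λ d → - f d) v                ≡⟨ inflow-∑ _ v ⟩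
    ∑[ d < nD ] inflowTerm v (-_ ∘ f) d     ≡⟨ sum-cong-≗ (λ d → if-neg (does (hd G d ≟ v)) (f d)) ⟩
    ∑[ d < nD ] (- inflowTerm v f d)        ≡⟨ ∑-neg (inflowTerm v f) ⟩
    - ∑[ d < nD ] inflowTerm v f d          ≡⟨ cong -_ (sym (inflow-∑ f v)) ⟩
    - inflow G f v                          ∎
    where open ≡-Reasoning

  inflow-* : ∀ k f v → inflow G (λ d → k * f d) v ≡ k * inflow G f v
  inflow-* k f v = begin
    inflow G (λ d → k * f d) v              ≡⟨ inflow-∑ _ v ⟩
    ∑[ d < nD ] inflowTerm v ((k *_) ∘ f) d   ≡⟨ sum-cong-≗ (λ d → if-* (does (hd G d ≟ v)) k (f d)) ⟩
    ∑[ d < nD ] (k * inflowTerm v f d)      ≡⟨ sym (*-distribˡ-sum k (inflowTerm v f)) ⟩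
    k * ∑[ d < nD ] inflowTerm v f d        ≡⟨ cong (k *_) (sym (inflow-∑ f v)) ⟩
    k * inflow G f v                        ∎
    where open ≡-Reasoning

  inflow-zero : ∀ v → inflow G (λ _ → 0ℚ) v ≡ 0ℚ
  inflow-zero v = trans (inflow-∑ _ v) (trans (sum-cong-≗ zero-if) (sum-replicate-zero nD))
    where
    zero-if : ∀ d → inflowTerm v (λ _ → 0ℚ) d ≡ 0ℚ
    zero-if d with does (hd G d ≟ v)
    ... | true  = refl
    ... | false = refl

  inflow-indicator : ∀ d v → inflow G (indicator d) v ≡ indicator (hd G d) v
  inflow-indicator d v =
    trans (inflow-∑ _ v) (trans (sum-cong-≗ only-d) (∑-indicator d (λ _ → indicator (hd G d) v)))
    where
    only-d : ∀ e → inflowTerm v (indicator d) e ≡ (if does (d ≟ e) then indicator (hd G d) v else 0ℚ)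
    only-d e with d ≟ e
    ... | yes refl = refl
    ... | no _ with does (hd G e ≟ v)
    ...   | true  = refl
    ...   | false = refl

  IsAntisymmetric : (Dart G → ℚ) → Set
  IsAntisymmetric f = ∀ d → f (rev d) ≡ - f d

  Nonnegative : Cap G → Set
  Nonnegative c = ∀ d → 0ℚ ≤ c d

  residual-nonneg : ∀ {c f} → IsPseudoflow G c f → Nonnegative (residual G c f)
  residual-nonneg {c} {f} (_ , f≤c) d =
    subst (_≤ c d - f d) (ℚP.+-inverseʳ (f d)) (ℚP.+-monoˡ-≤ (- f d) (f≤c d))

  rev-nonpos⇒nonneg : ∀ {f} → IsAntisymmetric f → ∀ d → f (rev d) ≤ 0ℚ → 0ℚ ≤ f d
  rev-nonpos⇒nonneg {f} anti d f-rev≤0 =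
    subst (0ℚ ≤_) (trans (cong -_ (anti d)) (⁻¹-involutive (f d))) (ℚP.neg-antimono-≤ f-rev≤0)

  -- Cuts

  ResidualClosed : Cap G → Pred (Vertex G) 0ℓ → Set
  ResidualClosed c S = ∀ d → S (tl d) → 0ℚ ℚ.< c d → S (hd G d)

  residualClosed-walk : ∀ {c S x y} → ResidualClosed c S → S x → HasResidualWalk c x y → S y
  residualClosed-walk closed Sx ([] , [])          = Sx
  residualClosed-walk closed Sx (d ∷ p , r ∷ res) = residualClosed-walk closed (closed d Sx r) (p , res)

  reachable-residualClosed : ∀ c x → ResidualClosed c (HasResidualWalk c x)
  reachable-residualClosed c x d reach-tl r = residualWalk-∷ʳ d reach-tl r

  unreaching-residualClosed : ∀ c y → ResidualClosed c (λ v → ¬ HasResidualWalk c v y)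
  unreaching-residualClosed c y d ¬reach-tl r (p , res) = ¬reach-tl (d ∷ p , r ∷ res)

  leaving⇒cap≤0 : ∀ {c S} → ResidualClosed c S → ∀ d → S (tl d) → ¬ S (hd G d) → c d ≤ 0ℚ
  leaving⇒cap≤0 closed d Stl ¬Shd = ℚP.≮⇒≥ (λ r → ¬Shd (closed d Stl r))

  module _ {S : Pred (Vertex G) 0ℓ} (S? : Decidable S) where

    inflowInto : (Dart G → ℚ) → ℚ
    inflowInto f = ∑[ v < nV ] (if does (S? v) then inflow G f v else 0ℚ)

    inflowInto≡∑heads : ∀ f → inflowInto f ≡ ∑[ d < nD ] (if does (S? (hd G d)) then f d else 0ℚ)
    inflowInto≡∑heads f = begin
      inflowInto f                          ≡⟨ sum-cong-≗ expand ⟩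
      ∑[ v < nV ] ∑[ d < nD ] term v d      ≡⟨ ∑-comm term ⟩
      ∑[ d < nD ] ∑[ v < nV ] term v d      ≡⟨ sum-cong-≗ (λ d → trans (sum-cong-≗ (swap d))
                                                 (∑-indicator (hd G d) (λ _ → headTerm d))) ⟩
      ∑[ d < nD ] headTerm d                ∎
      where
      open ≡-Reasoning
      term : Vertex G → Dart G → ℚ
      term v d = if does (S? v) then inflowTerm v f d else 0ℚ
      headTerm : Dart G → ℚ
      headTerm d = if does (S? (hd G d)) then f d else 0ℚ
      expand : ∀ v → (if does (S? v) then inflow G f v else 0ℚ) ≡ ∑[ d < nD ] term v d
      expand v with does (S? v)
      ... | true  = inflow-∑ f v
      ... | false = sym (sum-replicate-zero nD)
      swap : ∀ d v → (if does (S? v) then (if does (hd G d ≟ v) then f d else 0ℚ) else 0ℚ) ≡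
                     (if does (hd G d ≟ v) then headTerm d else 0ℚ)
      swap d v with hd G d ≟ v
      ... | yes refl = refl
      ... | no _ with does (S? v)
      ...   | true  = refl
      ...   | false = refl

    enteringFlow internalFlow : (Dart G → ℚ) → Dart G → ℚ
    enteringFlow f d = if does (S? (hd G d)) then (if does (S? (tl d)) then 0ℚ else f d) else 0ℚ
    internalFlow f d = if does (S? (hd G d)) then (if does (S? (tl d)) then f d else 0ℚ) else 0ℚ

    internalFlow-antisymmetric : ∀ {f} → IsAntisymmetric f → IsAntisymmetric (internalFlow f)
    internalFlow-antisymmetric {f} anti d = goal
      where
      goal : (if does (S? (hd G (rev d))) then (if does (S? (hd G d)) then f (rev d) else 0ℚ) else 0ℚ) ≡
             - internalFlow f d
      goal rewrite hd-rev d with S? (tl d) | S? (hd G d)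
      ... | yes _ | yes _ = anti d
      ... | yes _ | no _  = refl
      ... | no _  | yes _ = refl
      ... | no _  | no _  = refl

    inflowInto≡∑entering : ∀ {f} → IsAntisymmetric f → inflowInto f ≡ ∑[ d < nD ] enteringFlow f d
    inflowInto≡∑entering {f} anti = begin
      inflowInto f                                                ≡⟨ inflowInto≡∑heads f ⟩
      ∑[ d < nD ] (if does (S? (hd G d)) then f d else 0ℚ)        ≡⟨ sum-cong-≗ split ⟩
      ∑[ d < nD ] (enteringFlow f d + internalFlow f d)           ≡⟨ ∑-distrib-+ (enteringFlow f) (internalFlow f) ⟩
      ∑[ d < nD ] enteringFlow f d + ∑[ d < nD ] internalFlow f d ≡⟨ cong (∑[ d < nD ] enteringFlow f d +_) internal≡0 ⟩
      ∑[ d < nD ] enteringFlow f d + 0ℚ                           ≡⟨ ℚP.+-identityʳ _ ⟩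
      ∑[ d < nD ] enteringFlow f d                                ∎
      where
      open ≡-Reasoning
      internal≡0 = ∑-antisymmetric rev rev-invol (internalFlow f) (internalFlow-antisymmetric anti)
      split : ∀ d → (if does (S? (hd G d)) then f d else 0ℚ) ≡ enteringFlow f d + internalFlow f d
      split d with does (S? (hd G d)) | does (S? (tl d))
      ... | true  | true  = sym (ℚP.+-identityˡ (f d))
      ... | true  | false = sym (ℚP.+-identityʳ (f d))
      ... | false | _     = refl

    enteringFlow-nonneg : ∀ {c f} → IsPseudoflow G c f → ResidualClosed c S → ∀ d → 0ℚ ≤ enteringFlow f d
    enteringFlow-nonneg {c} {f} (anti , f≤c) closed d with S? (hd G d) | S? (tl d)
    ... | yes _   | yes _   = ℚP.≤-refl
    ... | no _    | _       = ℚP.≤-refl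
    ... | yes Shd | no ¬Stl = rev-nonpos⇒nonneg anti d
      (ℚP.≤-trans (f≤c (rev d)) (leaving⇒cap≤0 {S = S} closed (rev d) Shd (¬Stl ∘ subst S (hd-rev d))))

    enteringFlow-rev-leaving : ∀ f d → S (tl d) → ¬ S (hd G d) → enteringFlow f (rev d) ≡ f (rev d)
    enteringFlow-rev-leaving f d Stl ¬Shd = goal
      where
      goal : (if does (S? (hd G (rev d))) then (if does (S? (hd G d)) then 0ℚ else f (rev d)) else 0ℚ) ≡ f (rev d)
      goal rewrite hd-rev d with S? (tl d) | S? (hd G d)
      ... | yes _    | no _    = refl
      ... | no ¬Stl  | _       = contradiction Stl ¬Stl
      ... | yes _    | yes Shd = contradiction Shd ¬Shd

    residualClosed-residual : ∀ {c f} → IsPseudoflow G c f → ResidualClosed c S →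
                              inflowInto f ≤ 0ℚ → ResidualClosed (residual G c f) S
    residualClosed-residual {c} {f} pseudo@(anti , _) closed into≤0 d Stl r with S? (hd G d)
    ... | yes Shd = Shd
    ... | no ¬Shd = contradiction (ℚP.<-≤-trans r residual≤0) (ℚP.<-irrefl refl)
      where
      open ℚP.≤-Reasoning
      rev-flow≤0 : f (rev d) ≤ 0ℚ
      rev-flow≤0 = begin
        f (rev d)                       ≡⟨ enteringFlow-rev-leaving f d Stl ¬Shd ⟨
        enteringFlow f (rev d)          ≤⟨ term≤∑ (enteringFlow f) (enteringFlow-nonneg pseudo closed) (rev d) ⟩
        ∑[ e < nD ] enteringFlow f e    ≡⟨ inflowInto≡∑entering anti ⟨
        inflowInto f                    ≤⟨ into≤0 ⟩
        0ℚ                              ∎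
      residual≤0 : c d - f d ≤ 0ℚ
      residual≤0 = begin
        c d - f d   ≤⟨ ℚP.+-monoʳ-≤ (c d) (ℚP.neg-antimono-≤ (rev-nonpos⇒nonneg anti d rev-flow≤0)) ⟩
        c d - 0ℚ    ≡⟨ ℚP.+-identityʳ (c d) ⟩
        c d         ≤⟨ leaving⇒cap≤0 {S = S} closed d Stl ¬Shd ⟩
        0ℚ          ∎

  module _ {c s t f} (flow : IsSTFlow G c s t f) (s≢t : s ≢ t) where

    inflowInto-terminals : ∀ {S : Pred (Vertex G) 0ℓ} (S? : Decidable S) →
      inflowInto S? f ≡ (if does (S? s) then inflow G f s else 0ℚ) + (if does (S? t) then inflow G f t else 0ℚ)
    inflowInto-terminals S? = begin
      ∑[ v < nV ] restricted v                            ≡⟨ sum-cong-≗ only-terminals ⟩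
      ∑[ v < nV ] (atSource v + atSink v)                 ≡⟨ ∑-distrib-+ atSource atSink ⟩
      ∑[ v < nV ] atSource v + ∑[ v < nV ] atSink v       ≡⟨ cong₂ _+_ (∑-indicator s _) (∑-indicator t _) ⟩
      restricted s + restricted t                         ∎
      where
      open ≡-Reasoning
      restricted atSource atSink : Vertex G → ℚ
      restricted v = if does (S? v) then inflow G f v else 0ℚ
      atSource v = if does (s ≟ v) then restricted s else 0ℚ
      atSink v = if does (t ≟ v) then restricted t else 0ℚ
      only-terminals : ∀ v → restricted v ≡ atSource v + atSink v
      only-terminals v with s ≟ v | t ≟ v
      ... | yes refl | yes refl = contradiction refl s≢t
      ... | yes refl | no _     = sym (ℚP.+-identityʳ _)
      ... | no _     | yes refl = sym (ℚP.+-identityˡ _)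
      ... | no v≢s   | no v≢t with does (S? v)
      ...   | false = refl
      ...   | true  = proj₂ flow v λ { (inj₁ refl) → v≢s refl ; (inj₂ refl) → v≢t refl }

    inflow-source+sink : inflow G f s + inflow G f t ≡ 0ℚ
    inflow-source+sink = begin
      inflow G f s + inflow G f t   ≡⟨ inflowInto-terminals U? ⟨
      inflowInto U? f               ≡⟨ inflowInto≡∑heads U? f ⟩
      sum f                         ≡⟨ ∑-antisymmetric rev rev-invol f (proj₁ (proj₁ flow)) ⟩
      0ℚ                            ∎
      where open ≡-Reasoning

    inflowInto-nonpos : 0ℚ ≤ inflow G f t → ∀ {S : Pred (Vertex G) 0ℓ} (S? : Decidable S) →
                        ¬ S t ⊎ S s → inflowInto S? f ≤ 0ℚ
    inflowInto-nonpos value≥0 S? side = subst (_≤ 0ℚ) (sym (inflowInto-terminals S?)) (by-cases (S? s) (S? t))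
      where
      by-cases : ∀ s? t? → (if does s? then inflow G f s else 0ℚ) + (if does t? then inflow G f t else 0ℚ) ≤ 0ℚ
      by-cases (yes _)  (yes _)  = ℚP.≤-reflexive inflow-source+sink
      by-cases (yes _)  (no _)   =
        ℚP.≤-trans (ℚP.+-monoʳ-≤ (inflow G f s) value≥0) (ℚP.≤-reflexive inflow-source+sink)
      by-cases (no _)   (no _)   = ℚP.≤-refl
      by-cases (no ¬Ss) (yes St) = contradiction₂ side (λ ¬St → ¬St St) ¬Ss

    module _ (value≥0 : 0ℚ ≤ inflow G f t) where

      ¬residualPath-acrossCut : ∀ {S : Pred (Vertex G) 0ℓ} (S? : Decidable S) → ResidualClosed c S →
                                ¬ S t ⊎ S s → ∀ {x y} → S x → ¬ S y → ¬ HasResidualPath G (residual G c f) x y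
      ¬residualPath-acrossCut S? closed side Sx ¬Sy (p , _ , res) =
        ¬Sy (residualClosed-walk closed′ Sx (p , res))
        where
        closed′ = residualClosed-residual S? (proj₁ flow) closed (inflowInto-nonpos value≥0 S? side)

      ¬residualPath-avoidingSink : ∀ {x y} → ¬ HasResidualPath G c x y → ¬ HasResidualPath G c x t →
                                   ¬ HasResidualPath G (residual G c f) x y
      ¬residualPath-avoidingSink {x} ¬xy ¬xt path = ¬¬-decidable (HasResidualWalk c x) λ reach? →
        ¬residualPath-acrossCut reach? (reachable-residualClosed c x)
          (inj₁ (¬residualPath⇒¬residualWalk ¬xt)) ([] , []) (¬residualPath⇒¬residualWalk ¬xy) path

      ¬residualPath-avoidingSource : ∀ {x y} → ¬ HasResidualPath G c x y → ¬ HasResidualPath G c s y →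
                                     ¬ HasResidualPath G (residual G c f) x y
      ¬residualPath-avoidingSource {y = y} ¬xy ¬sy path = ¬¬-decidable (λ v → ¬ HasResidualWalk c v y) λ ¬reach? →
        ¬residualPath-acrossCut ¬reach? (unreaching-residualClosed c y)
          (inj₂ (¬residualPath⇒¬residualWalk ¬sy)) (¬residualPath⇒¬residualWalk ¬xy) (λ ¬yy → ¬yy ([] , [])) path

  -- Augmenting paths

  pathFlow : ∀ {x y} → Walk G x y → Dart G → ℚ
  pathFlow []      e = 0ℚ
  pathFlow (d ∷ p) e = (indicator d e - indicator (rev d) e) + pathFlow p e

  pathFlow-antisymmetric : ∀ {x y} (p : Walk G x y) → IsAntisymmetric (pathFlow p)
  pathFlow-antisymmetric []      e = refl
  pathFlow-antisymmetric (d ∷ p) e = begin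
    (indicator d (rev e) - indicator (rev d) (rev e)) + pathFlow p (rev e)
      ≡⟨ cong₂ (λ a b → (a - b) + pathFlow p (rev e)) (indicator-involution rev rev-invol d e) rev-rev ⟩
    (indicator (rev d) e - indicator d e) + pathFlow p (rev e)
      ≡⟨ cong ((indicator (rev d) e - indicator d e) +_) (pathFlow-antisymmetric p e) ⟩
    (indicator (rev d) e - indicator d e) + - pathFlow p e
      ≡⟨ solve 3 (λ a b x → (b :- a) :+ (:- x) := :- ((a :- b) :+ x)) refl
           (indicator d e) (indicator (rev d) e) (pathFlow p e) ⟩
    - ((indicator d e - indicator (rev d) e) + pathFlow p e)  ∎
    where
    open ≡-Reasoning
    open +-*-Solver
    rev-rev : indicator (rev d) (rev e) ≡ indicator d e
    rev-rev = trans (indicator-involution rev rev-invol (rev d) e) (cong (λ w → indicator w e) (rev-invol d))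

  inflow-unitFlow : ∀ d v → inflow G (λ e → indicator d e - indicator (rev d) e) v ≡ indicator (hd G d) v - indicator (tl d) v
  inflow-unitFlow d v = begin
    inflow G (λ e → indicator d e - indicator (rev d) e) v             ≡⟨ inflow-+ (indicator d) (-_ ∘ indicator (rev d)) v ⟩
    inflow G (indicator d) v + inflow G (-_ ∘ indicator (rev d)) v     ≡⟨ cong (inflow G (indicator d) v +_) (inflow-neg (indicator (rev d)) v) ⟩
    inflow G (indicator d) v - inflow G (indicator (rev d)) v          ≡⟨ cong₂ _-_ (inflow-indicator d v) (inflow-indicator (rev d) v) ⟩
    indicator (hd G d) v - indicator (hd G (rev d)) v                  ≡⟨ cong (λ w → indicator (hd G d) v - indicator w v) (hd-rev d) ⟩
    indicator (hd G d) v - indicator (tl d) v                          ∎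
    where open ≡-Reasoning

  inflow-pathFlow : ∀ {x y} (p : Walk G x y) v → inflow G (pathFlow p) v ≡ indicator y v - indicator x v
  inflow-pathFlow {x} []      v = trans (inflow-zero v) (sym (ℚP.+-inverseʳ (indicator x v)))
  inflow-pathFlow {y = y} (d ∷ p) v = begin
    inflow G (pathFlow (d ∷ p)) v                                            ≡⟨ inflow-+ _ (pathFlow p) v ⟩
    inflow G (λ e → indicator d e - indicator (rev d) e) v + inflow G (pathFlow p) v
                                                                             ≡⟨ cong₂ _+_ (inflow-unitFlow d v) (inflow-pathFlow p v) ⟩
    (indicator (hd G d) v - indicator (tl d) v) + (indicator y v - indicator (hd G d) v)
                                                                             ≡⟨ solve 3 (λ a b c → (a :- b) :+ (c :- a) := c :- b) refl
                                                                                  (indicator (hd G d) v) (indicator (tl d) v) (indicator y v) ⟩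
    indicator y v - indicator (tl d) v                                       ∎
    where
    open ≡-Reasoning
    open +-*-Solver

  tl∈vertices : ∀ {x y} (p : Walk G x y) {e} → e ∈ darts G p → tl e ∈ vertices G p
  tl∈vertices (d ∷ p) (here refl) = here refl
  tl∈vertices (d ∷ p) (there e∈p) = there (tl∈vertices p e∈p)

  pathFlow-bound : ∀ {x y} (p : Walk G x y) → IsSimplePath G p → ∀ e →
                   pathFlow p e ≤ 1ℚ × (0ℚ ℚ.< pathFlow p e → e ∈ darts G p)
  pathFlow-bound []      _ e = ℚP.<⇒≤ (ℚP.positive⁻¹ 1ℚ) , λ 0<0 → contradiction 0<0 (ℚP.<-irrefl refl)
  pathFlow-bound (d ∷ p) (tl∉p ∷ simple) e with d ≟ e | rev d ≟ e | pathFlow-bound p simple e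
  ... | yes refl | yes d≡rd | _ = contradiction d≡rd (rev-nofix d)
  ... | yes refl | no _ | _ , pos⇒∈ =
    ℚP.+-monoʳ-≤ 1ℚ (ℚP.≮⇒≥ λ pos → All.lookup tl∉p (tl∈vertices p (pos⇒∈ pos)) refl) , λ _ → here refl
  ... | no _ | yes refl | ≤1 , _ =
    ℚP.≤-trans ≤0 (ℚP.<⇒≤ (ℚP.positive⁻¹ 1ℚ)) , λ pos → contradiction (ℚP.<-≤-trans pos ≤0) (ℚP.<-irrefl refl)
    where
    ≤0 : (0ℚ - 1ℚ) + pathFlow p (rev d) ≤ 0ℚ
    ≤0 = ℚP.+-monoʳ-≤ (0ℚ - 1ℚ) ≤1
  ... | no _ | no _ | ≤1 , pos⇒∈ =
    subst (_≤ 1ℚ) (sym (ℚP.+-identityˡ _)) ≤1 , λ pos → there (pos⇒∈ (subst (0ℚ ℚ.<_) (ℚP.+-identityˡ _) pos))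

  bottleneck : ∀ (c : Cap G) {x y} (p : Walk G x y) → ResidualWalk G c p →
               Σ ℚ λ ε → 0ℚ ℚ.< ε × All (λ d → ε ≤ c d) (darts G p)
  bottleneck c []      [] = 1ℚ , ℚP.positive⁻¹ 1ℚ , []
  bottleneck c (d ∷ p) (r ∷ res) with bottleneck c p res
  ... | ε , ε>0 , ε≤ = c d ℚ.⊓ ε , min>0 , ℚP.p⊓q≤p (c d) ε ∷ All.map (ℚP.≤-trans (ℚP.p⊓q≤q (c d) ε)) ε≤
    where
    min>0 : 0ℚ ℚ.< c d ℚ.⊓ ε
    min>0 with ℚP.⊓-sel (c d) ε
    ... | inj₁ min≡c = subst (0ℚ ℚ.<_) (sym min≡c) r
    ... | inj₂ min≡ε = subst (0ℚ ℚ.<_) (sym min≡ε) ε>0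

  module Augmentation {c s t f} (flow : IsSTFlow G c s t f) {P : Walk G s t} (simple : IsSimplePath G P)
           {ε} (ε≥0 : 0ℚ ≤ ε) (ε≤residual : All (λ d → ε ≤ residual G c f d) (darts G P)) where

    augmented : Dart G → ℚ
    augmented d = f d + ε * pathFlow P d

    inflow-augmented : ∀ v → inflow G augmented v ≡ inflow G f v + ε * (indicator t v - indicator s v)
    inflow-augmented v = begin
      inflow G augmented v                       ≡⟨ inflow-+ f ((ε *_) ∘ pathFlow P) v ⟩
      inflow G f v + inflow G ((ε *_) ∘ pathFlow P) v ≡⟨ cong (inflow G f v +_) (inflow-* ε (pathFlow P) v) ⟩
      inflow G f v + ε * inflow G (pathFlow P) v  ≡⟨ cong (λ x → inflow G f v + ε * x) (inflow-pathFlow P v) ⟩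
      inflow G f v + ε * (indicator t v - indicator s v) ∎
      where open ≡-Reasoning

    augmented-antisymmetric : IsAntisymmetric augmented
    augmented-antisymmetric e = begin
      f (rev e) + ε * pathFlow P (rev e)   ≡⟨ cong₂ (λ a b → a + ε * b) (proj₁ (proj₁ flow) e) (pathFlow-antisymmetric P e) ⟩
      - f e + ε * - pathFlow P e           ≡⟨ solve 3 (λ a x h → :- a :+ x :* (:- h) := :- (a :+ x :* h)) refl (f e) ε (pathFlow P e) ⟩
      - (f e + ε * pathFlow P e)           ∎
      where
      open ≡-Reasoning
      open +-*-Solver

    augmented≤cap : ∀ e → augmented e ≤ c e
    augmented≤cap e with pathFlow P e ℚP.≤? 0ℚ | pathFlow-bound P simple e
    ... | yes off-path | _ = begin
      f e + ε * pathFlow P e  ≤⟨ ℚP.+-monoʳ-≤ (f e) (ℚP.*-monoˡ-≤-nonNeg ε {{ℚ.nonNegative ε≥0}} off-path) ⟩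
      f e + ε * 0ℚ            ≡⟨ cong (f e +_) (ℚP.*-zeroʳ ε) ⟩
      f e + 0ℚ                ≡⟨ ℚP.+-identityʳ (f e) ⟩
      f e                     ≤⟨ proj₂ (proj₁ flow) e ⟩
      c e                     ∎
      where open ℚP.≤-Reasoning
    ... | no on-path | ≤1 , pos⇒∈ = begin
      f e + ε * pathFlow P e  ≤⟨ ℚP.+-monoʳ-≤ (f e) (ℚP.*-monoˡ-≤-nonNeg ε {{ℚ.nonNegative ε≥0}} ≤1) ⟩
      f e + ε * 1ℚ            ≡⟨ cong (f e +_) (ℚP.*-identityʳ ε) ⟩
      f e + ε                 ≤⟨ ℚP.+-monoʳ-≤ (f e) (All.lookup ε≤residual (pos⇒∈ (ℚP.≰⇒> on-path))) ⟩
      f e + (c e - f e)       ≡⟨ solve 2 (λ a b → a :+ (b :- a) := b) refl (f e) (c e) ⟩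
      c e                     ∎
      where
      open ℚP.≤-Reasoning
      open +-*-Solver

    augmented-isSTFlow : IsSTFlow G c s t augmented
    augmented-isSTFlow = (augmented-antisymmetric , augmented≤cap) , balanced
      where
      balanced : ∀ v → ¬ (v ≡ s ⊎ v ≡ t) → inflow G augmented v ≡ 0ℚ
      balanced v non-terminal = begin
        inflow G augmented v                               ≡⟨ inflow-augmented v ⟩
        inflow G f v + ε * (indicator t v - indicator s v)  ≡⟨ cong₂ (λ a b → a + ε * b) (proj₂ flow v non-terminal)
                                                                 (cong₂ _-_ (indicator-≢ (non-terminal ∘ inj₂ ∘ sym))
                                                                            (indicator-≢ (non-terminal ∘ inj₁ ∘ sym))) ⟩
        0ℚ + ε * (0ℚ - 0ℚ)                                 ≡⟨ cong (0ℚ +_) (ℚP.*-zeroʳ ε) ⟩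
        0ℚ                                                 ∎
        where open ≡-Reasoning

    inflow-augmented-sink : s ≢ t → inflow G augmented t ≡ inflow G f t + ε
    inflow-augmented-sink s≢t = begin
      inflow G augmented t                                ≡⟨ inflow-augmented t ⟩
      inflow G f t + ε * (indicator t t - indicator s t)  ≡⟨ cong (λ x → inflow G f t + ε * (x - indicator s t)) (indicator-refl t) ⟩
      inflow G f t + ε * (1ℚ - indicator s t)             ≡⟨ cong (λ x → inflow G f t + ε * (1ℚ - x)) (indicator-≢ s≢t) ⟩
      inflow G f t + ε * 1ℚ                               ≡⟨ cong (inflow G f t +_) (ℚP.*-identityʳ ε) ⟩
      inflow G f t + ε                                    ∎
      where open ≡-Reasoning

  maxFlow⇒¬augmentingPath : ∀ {c s t f} → IsMaxSTFlow G c s t f → s ≢ t → ¬ HasResidualPath G (residual G c f) s t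
  maxFlow⇒¬augmentingPath {c} {s} {t} {f} (flow , maximal) s≢t (P , simple , res)
    with bottleneck (residual G c f) P res
  ... | ε , ε>0 , ε≤residual = ℚP.<-irrefl refl (ℚP.<-≤-trans value<augmented (maximal augmented augmented-isSTFlow))
    where
    open Augmentation flow simple (ℚP.<⇒≤ ε>0) ε≤residual
    open ℚP.≤-Reasoning
    value<augmented : inflow G f t ℚ.< inflow G augmented t
    value<augmented = begin-strict
      inflow G f t          ≡⟨ ℚP.+-identityʳ _ ⟨
      inflow G f t + 0ℚ     <⟨ ℚP.+-monoʳ-< (inflow G f t) ε>0 ⟩
      inflow G f t + ε      ≡⟨ inflow-augmented-sink s≢t ⟨
      inflow G augmented t  ∎

  maxFlow-value-nonneg : ∀ {c s t f} → Nonnegative c → IsMaxSTFlow G c s t f → 0ℚ ≤ inflow G f t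
  maxFlow-value-nonneg {t = t} {f} c≥0 (_ , maximal) =
    subst (_≤ inflow G f t) (inflow-zero t) (maximal (λ _ → 0ℚ) (((λ _ → refl) , c≥0) , λ v _ → inflow-zero v))

-- The loop of AbstractFlow

module _ {G : PlaneGraph} (T : Terminals G) where
  open Terminals T

  NoBackwardPath : Cap G → Set
  NoBackwardPath c = ∀ i j → j < i → i < m → ¬ HasResidualPath G c (s i) (t j)

  NoPathToSinkFrom : Cap G → ℕ → ℕ → Set
  NoPathToSinkFrom c i j = ∀ a → i ℕ.≤ a → a ℕ.≤ j → ¬ HasResidualPath G c (s a) (t j)

  noPathToSinkFrom-empty : ∀ c j → NoPathToSinkFrom c (suc j) j
  noPathToSinkFrom-empty c j a j<a a≤j = contradiction a≤j (ℕP.<⇒≱ j<a)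

  LoopInvariant : Cap G → ℕ → ℕ → Set
  LoopInvariant c i j = Nonnegative G c × NoBackwardPath c × NoPathToSinkFrom c i j

  LoopInvariant-cong : ∀ {c c′ i j} → (∀ d → c d ≡ c′ d) → LoopInvariant c i j → LoopInvariant c′ i j
  LoopInvariant-cong c≗c′ (c≥0 , noBack , noToSink) =
    (λ d → subst (0ℚ ≤_) (c≗c′ d) (c≥0 d)) ,
    (λ i j j<i i<m → ¬residualPath-cong G c≗c′ (noBack i j j<i i<m)) ,
    (λ a i≤a a≤j → ¬residualPath-cong G c≗c′ (noToSink a i≤a a≤j))

  loopInvariant-step : ∀ {c f i j} → i ℕ.≤ j → j < m → IsMaxSTFlow G c (s i) (t j) f →
                       LoopInvariant c (suc i) j → LoopInvariant (residual G c f) i j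
  loopInvariant-step {c} {f} {i} {j} i≤j j<m maxFlow (c≥0 , noBack , noToSink) =
    residual-nonneg G (proj₁ (proj₁ maxFlow)) , noBack′ , noToSink′
    where
    i<m = ℕP.≤-<-trans i≤j j<m
    s≢t = st-disj i j i<m j<m
    value≥0 = maxFlow-value-nonneg G c≥0 maxFlow
    avoidingSink = ¬residualPath-avoidingSink G (proj₁ maxFlow) s≢t value≥0
    avoidingSource = ¬residualPath-avoidingSource G (proj₁ maxFlow) s≢t value≥0
    noBack′ : NoBackwardPath (residual G c f)
    noBack′ a b b<a a<m with b ℕP.<? i | a ℕP.≤? j
    ... | yes b<i | _       = avoidingSource (noBack a b b<a a<m) (noBack i b b<i i<m)
    ... | no b≮i  | yes a≤j = avoidingSink (noBack a b b<a a<m) (noToSink a (ℕP.≤-<-trans (ℕP.≮⇒≥ b≮i) b<a) a≤j)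
    ... | no _    | no a≰j  = avoidingSink (noBack a b b<a a<m) (noBack a j (ℕP.≰⇒> a≰j) a<m)
    noToSink′ : NoPathToSinkFrom (residual G c f) i j
    noToSink′ a i≤a a≤j with i ℕP.≟ a
    ... | yes refl = maxFlow⇒¬augmentingPath G maxFlow s≢t
    ... | no i≢a   = avoidingSink ¬path ¬path
      where ¬path = noToSink a (ℕP.≤∧≢⇒< i≤a i≢a) a≤j

module _ {G : PlaneGraph} {T : Terminals G} {c : Cap G} (R : AbstractFlowRun G T c) where
  open Terminals T
  open AbstractFlowRun R

  c₀-noBackwardPath : NoBackwardPath T c₀
  c₀-noBackwardPath i j j<i i<m = c₀-noBack j i j<i i<m

  loopInvariant-cout : ∀ {i j} → i ℕ.≤ j → j < m → LoopInvariant T (cin i j) (suc i) j → LoopInvariant T (cout i j) i j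
  loopInvariant-cout {i} {j} i≤j j<m inv =
    LoopInvariant-cong T (sym ∘ cout-def i j i≤j j<m) (loopInvariant-step T i≤j j<m (fl-max i j i≤j j<m) inv)

  mutual
    loopInvariant-diagonal : ∀ j → j < m → LoopInvariant T (cin j j) (suc j) j
    loopInvariant-diagonal zero _ = LoopInvariant-cong T (sym ∘ cin-first)
      (residual-nonneg G (proj₁ f₀-flow) , c₀-noBackwardPath , noPathToSinkFrom-empty T c₀ 0)
    loopInvariant-diagonal (suc j) 1+j<m = LoopInvariant-cong T (sym ∘ cin-diag j 1+j<m)
      (c≥0 , noBack , noPathToSinkFrom-empty T (cout 0 j) (suc j))
      where
      previous = loopInvariant-column j (ℕP.<-trans (ℕP.n<1+n j) 1+j<m) 0 ℕ.z≤n
      c≥0 = proj₁ previous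
      noBack = proj₁ (proj₂ previous)

    loopInvariant-column : ∀ j → j < m → ∀ i → i ℕ.≤ j → LoopInvariant T (cout i j) i j
    loopInvariant-column j j<m = downwardInduction
      (loopInvariant-cout ℕP.≤-refl j<m (loopInvariant-diagonal j j<m))
      (λ i i<j inv → loopInvariant-cout (ℕP.<⇒≤ i<j) j<m (LoopInvariant-cong T (sym ∘ cin-off i j i<j j<m) inv))

mainTheorem4 : (G : PlaneGraph) (T : Terminals G) (c : Cap G) →
    (∀ d → 0ℚ ≤ c d) →
    (R : AbstractFlowRun G T c) →
    let open Terminals T
        open AbstractFlowRun R
    in (∀ i j → j < i → i < m → ¬ HasResidualPath G c₀ (s i) (t j))
       × (∀ k l → k < l → l < m → ∀ i j → j < i → i < m →
            ¬ HasResidualPath G (cout k l) (s i) (t j))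
mainTheorem4 G T c _ R =
  c₀-noBackwardPath R ,
  λ k l k<l l<m → proj₁ (proj₂ (loopInvariant-column R l l<m k (ℕP.<⇒≤ k<l)))
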